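{- Let $\mathcal Q_1=(\mathbb Q\cap[0,1],+_1,\le,0)$ and, for $n>0$, $\mathcal S_n=(S_n,+_1,\le,0)$ with $S_n=\{0,\tfrac1n,\tfrac2n,\dots,1\}$, where $x+_1y=\min\{x+y,1\}$. Then $\mathrm{Th}_{\mathcal L_{\mathbb Q\cap[0,1]}}(\mathcal U_{\mathcal Q_1})=\bigcup_{n>0}\mathrm{Th}_{\mathcal L_{S_n}}(\mathcal U_{\mathcal S_n})$.
   Context: $\mathcal Q_1$ and each $\mathcal S_n$ are countable distance monoids (totally ordered commutative monoids with $r\le r+_1 s$ and $0$ least). For a countable distance monoid $\mathcal M=(M,\oplus,\le,0)$, an $\mathcal M$-metric space is a nonempty set with a map $d$ into $M$ satisfying $d(x,y)=0\iff x=y$, symmetry and $d(x,z)\le d(x,y)\oplus d(y,z)$; $\mathcal U_{\mathcal M}$ is the unique up to isometry countable ultrahomogeneous $\mathcal M$-metric space with distance set $M$ into which every finite $\mathcal M$-metric space embeds isometrically. For $S\subseteq\mathbb Q\cap[0,1]$, $\mathcal L_S$ is the relational language with a binary relation symbol $d(x,y)\le s$ for each $s\in S$, interpreted in a metric space as $\{(a,b):d(a,b)\le s\}$; thus $\mathcal L_{S_n}\subseteq\mathcal L_{\mathbb Q\cap[0,1]}$. -}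

module Defs where

open import Data.Nat as ℕ using (ℕ; zero; suc)
open import Data.Integer using (+_)
open import Data.Rational using (ℚ; 0ℚ; 1ℚ; _+_; _⊓_; _≤_; _/_)
open import Data.Fin using (Fin; zero; suc)
open import Data.Product using (Σ; _×_; _,_; ∃)
open import Data.Empty using (⊥)
open import Relation.Binary.PropositionalEquality using (_≡_)
open import Relation.Nullary using (¬_)
open import Data.Unit using (⊤)

_+₁_ : ℚ → ℚ → ℚ
x +₁ y = (x + y) ⊓ 1ℚ

Q01 : ℚ → Set
Q01 q = (0ℚ ≤ q) × (q ≤ 1ℚ)

-- S_n with n = suc m  :  { k / n | k ≤ n }   (so n ranges over n > 0)
S : ℕ → ℚ → Set
S m q = Σ ℕ λ k → (k ℕ.≤ suc m) × (q ≡ (+ k) / suc m)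

-- M-metric spaces, for M = (D, +₁, ≤, 0) a distance monoid with D ⊆ ℚ∩[0,1]

record MSpace (D : ℚ → Set) : Set₁ where
  field
    Carrier : Set
    d       : Carrier → Carrier → ℚ
    d-in    : ∀ x y → D (d x y)
    d-zero⇒ : ∀ x y → d x y ≡ 0ℚ → x ≡ y
    d-zero⇐ : ∀ x y → x ≡ y → d x y ≡ 0ℚ
    d-sym   : ∀ x y → d x y ≡ d y x
    d-tri   : ∀ x y z → d x z ≤ (d x y +₁ d y z)

record IsFinMetric (D : ℚ → Set) (k : ℕ) (δ : Fin k → Fin k → ℚ) : Set where
  field
    δ-in    : ∀ i j → D (δ i j)
    δ-zero⇒ : ∀ i j → δ i j ≡ 0ℚ → i ≡ j
    δ-zero⇐ : ∀ i j → i ≡ j → δ i j ≡ 0ℚ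
    δ-sym   : ∀ i j → δ i j ≡ δ j i
    δ-tri   : ∀ i j l → δ i l ≤ (δ i j +₁ δ j l)

record IsUrysohn (D : ℚ → Set) (U : MSpace D) : Set₁ where
  open MSpace U
  field
    countable : Σ (ℕ → Carrier) λ f → ∀ x → ∃ λ n → f n ≡ x
    distSet   : ∀ r → D r → Σ Carrier λ x → Σ Carrier λ y → d x y ≡ r
    universal : ∀ k (δ : Fin k → Fin k → ℚ) → IsFinMetric D k δ →
                Σ (Fin k → Carrier) λ e → ∀ i j → d (e i) (e j) ≡ δ i j
    ultrahomogeneous :
      ∀ k (a b : Fin k → Carrier) → (∀ i j → d (a i) (a j) ≡ d (b i) (b j)) →
      Σ (Carrier → Carrier) λ g →
        (∀ x y → d (g x) (g y) ≡ d x y) ×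
        (∀ y → Σ Carrier λ x → g x ≡ y) ×
        (∀ i → g (a i) ≡ b i)

-- First-order formulas with relation symbols  d(x,y) ≤ s  (s ∈ ℚ) and =,
-- de Bruijn variables; connectives ¬, ∧, ∀ (a complete set classically).

data Formula (n : ℕ) : Set where
  _≐_  : Fin n → Fin n → Formula n
  dle  : ℚ → Fin n → Fin n → Formula n
  ~_   : Formula n → Formula n
  _∧_  : Formula n → Formula n → Formula n
  all  : Formula (suc n) → Formula n

Sentence : Set
Sentence = Formula 0

InL : (ℚ → Set) → ∀ {n} → Formula n → Set
InL P (i ≐ j)    = ⊤
InL P (dle s i j) = P s
InL P (~ φ)      = InL P φ
InL P (φ ∧ ψ)    = InL P φ × InL P ψ
InL P (all φ)    = InL P φ

module _ {D : ℚ → Set} (M : MSpace D) where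
  open MSpace M

  ext : ∀ {n} → (Fin n → Carrier) → Carrier → Fin (suc n) → Carrier
  ext ρ x zero    = x
  ext ρ x (suc i) = ρ i

  Sat : ∀ {n} → Formula n → (Fin n → Carrier) → Set
  Sat (i ≐ j)     ρ = ρ i ≡ ρ j
  Sat (dle s i j) ρ = d (ρ i) (ρ j) ≤ s
  Sat (~ φ)       ρ = ¬ Sat φ ρ
  Sat (φ ∧ ψ)     ρ = Sat φ ρ × Sat ψ ρ
  Sat (all φ)     ρ = ∀ x → Sat φ (ext ρ x)

  noVars : Fin 0 → Carrier
  noVars ()

  _⊨_ : Sentence → Set
  _⊨_ φ = Sat φ noVars

InTh : (P : ℚ → Set) {D : ℚ → Set} → MSpace D → Sentence → Set
InTh P M φ = InL P φ × (M ⊨ φ)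

-- Tuples a in U_{S_m} and b in U_Q correspond when each pair of distances d(a_i,a_j), d(b_i,b_j)
-- lies below exactly the same thresholds s ∈ S_m (has the same ceiling in S_m). Such
-- correspondences preserve every L_{S_m}-formula, since they extend by one point in either
-- direction: a Katětov function over a finite tuple is realised in a Urysohn space (universality
-- realises it abstractly, ultrahomogeneity moves it onto the tuple). From U_Q to U_{S_m} one rounds
-- the new distances up to S_m; from U_{S_m} to U_Q one takes r_i = min(1, min_j d(b_i,b_j) + t_j),
-- which has the ceiling of t_i because S_m is closed under differences. An L_Q-sentence mentions
-- finitely many constants, all lying in S_m once m+1 is the product of their denominators.

module Submission where

open import Defs
open import Data.Nat as ℕ using (ℕ; zero; suc; z≤n)
import Data.Nat.Properties as ℕₚ
open import Data.Nat.Divisibility using (_∣_; divides; ∣-refl; ∣-trans; m∣m*n; n∣m*n)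
open import Data.Integer as ℤ using (+_; -[1+_])
import Data.Integer.Properties as ℤₚ
open import Data.Rational using (ℚ; mkℚ; 0ℚ; 1ℚ; _+_; -_; _⊓_; _≤_; _/_; toℚᵘ; *≤*)
open import Data.Rational.Properties
import Data.Rational.Unnormalised as ℚᵘ
import Data.Rational.Unnormalised.Properties as ℚᵘₚ
open import Data.Fin using (Fin; zero; suc)
import Data.Fin.Properties as Finₚ
open import Data.Product using (Σ; ∃; _×_; _,_; proj₁; proj₂)
open import Data.Sum using (_⊎_; inj₁; inj₂)
open import Data.Empty using (⊥-elim)
open import Data.Unit using (tt)
open import Function using (_∘_)
open import Function.Bundles using (_⇔_; mk⇔; Equivalence)
open import Function.Construct.Identity using (⇔-id)
open import Function.Related.TypeIsomorphisms using (¬-cong-⇔)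
open import Data.Product.Function.NonDependent.Propositional using (_×-⇔_)
open import Function.Definitions using (Injective)
open import Relation.Binary.Definitions using (DecidableEquality)
open import Relation.Binary.PropositionalEquality
open import Relation.Nullary using (yes; no)

frac : ℕ → ℕ → ℚ
frac m k = + k / suc m

toℚᵘ-frac : ∀ m k → toℚᵘ (frac m k) ℚᵘ.≃ ℚᵘ.mkℚᵘ (+ k) m
toℚᵘ-frac m k = toℚᵘ-fromℚᵘ (ℚᵘ.mkℚᵘ (+ k) m)

frac-mono-≤ : ∀ m {k l} → k ℕ.≤ l → frac m k ≤ frac m l
frac-mono-≤ m {k} {l} k≤l = toℚᵘ-cancel-≤ (begin
  toℚᵘ (frac m k)    ≃⟨ toℚᵘ-frac m k ⟩
  ℚᵘ.mkℚᵘ (+ k) m   ≤⟨ ℚᵘ.*≤* (ℤₚ.*-monoʳ-≤-nonNeg (+ suc m) (ℤ.+≤+ k≤l)) ⟩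
  ℚᵘ.mkℚᵘ (+ l) m   ≃⟨ ℚᵘₚ.≃-sym (toℚᵘ-frac m l) ⟩
  toℚᵘ (frac m l)    ∎)
  where open ℚᵘₚ.≤-Reasoning

frac-cancel-≤ : ∀ m {k l} → frac m k ≤ frac m l → k ℕ.≤ l
frac-cancel-≤ m {k} {l} k≤l
  with ℚᵘₚ.≤-respʳ-≃ (toℚᵘ-frac m l) (ℚᵘₚ.≤-respˡ-≃ (toℚᵘ-frac m k) (toℚᵘ-mono-≤ k≤l))
... | ℚᵘ.*≤* k*n≤l*n = ℤₚ.drop‿+≤+ (ℤₚ.*-cancelʳ-≤-pos (+ k) (+ l) (+ suc m) k*n≤l*n)

frac-+ : ∀ m k l → frac m k + frac m l ≡ frac m (k ℕ.+ l)
frac-+ m k l = toℚᵘ-injective (begin-equality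
  toℚᵘ (frac m k + frac m l)              ≃⟨ toℚᵘ-homo-+ (frac m k) (frac m l) ⟩
  toℚᵘ (frac m k) ℚᵘ.+ toℚᵘ (frac m l)    ≃⟨ ℚᵘₚ.+-cong (toℚᵘ-frac m k) (toℚᵘ-frac m l) ⟩
  ℚᵘ.mkℚᵘ (+ k) m ℚᵘ.+ ℚᵘ.mkℚᵘ (+ l) m    ≃⟨ ℚᵘ.*≡* common-denominator ⟩
  ℚᵘ.mkℚᵘ (+ (k ℕ.+ l)) m                 ≃⟨ ℚᵘₚ.≃-sym (toℚᵘ-frac m (k ℕ.+ l)) ⟩
  toℚᵘ (frac m (k ℕ.+ l))                 ∎)
  where
  open ℚᵘₚ.≤-Reasoning
  common-denominator : (+ k ℤ.* + suc m ℤ.+ + l ℤ.* + suc m) ℤ.* + suc m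
                     ≡ + (k ℕ.+ l) ℤ.* (+ suc m ℤ.* + suc m)
  common-denominator rewrite ℤₚ.pos-+ k l =
    trans (cong (ℤ._* + suc m) (sym (ℤₚ.*-distribʳ-+ (+ suc m) (+ k) (+ l))))
          (ℤₚ.*-assoc (+ k ℤ.+ + l) (+ suc m) (+ suc m))

frac-0 : ∀ m → frac m 0 ≡ 0ℚ
frac-0 m = 0/n≡0 (suc m)

frac-1 : ∀ m → frac m (suc m) ≡ 1ℚ
frac-1 m = toℚᵘ-injective (ℚᵘₚ.≃-trans (toℚᵘ-frac m (suc m)) (ℚᵘ.*≡* (ℤₚ.*-comm (+ suc m) (+ 1))))

frac-rescale : ∀ m n k c → suc m ≡ c ℕ.* suc n → frac m (k ℕ.* c) ≡ frac n k
frac-rescale m n k c m≡cn = toℚᵘ-injective (ℚᵘₚ.≃-trans (toℚᵘ-frac m (k ℕ.* c))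
  (ℚᵘₚ.≃-trans (ℚᵘ.*≡* cross) (ℚᵘₚ.≃-sym (toℚᵘ-frac n k))))
  where
  cross : + (k ℕ.* c) ℤ.* + suc n ≡ + k ℤ.* + suc m
  cross rewrite m≡cn | sym (ℤₚ.pos-* (k ℕ.* c) (suc n)) | sym (ℤₚ.pos-* k (c ℕ.* suc n)) =
    cong +_ (ℕₚ.*-assoc k c (suc n))

0≤1 : 0ℚ ≤ 1ℚ
0≤1 = ≤ᵇ⇒≤ tt

p≤p+q : ∀ p {q} → 0ℚ ≤ q → p ≤ p + q
p≤p+q p {q} 0≤q = subst (_≤ p + q) (+-identityʳ p) (+-monoʳ-≤ p 0≤q)

p≤q+p : ∀ p {q} → 0ℚ ≤ q → p ≤ q + p
p≤q+p p {q} 0≤q = subst (p ≤_) (+-comm p q) (p≤p+q p 0≤q)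

+-cancelˡ-≤ : ∀ r {p q} → r + p ≤ r + q → p ≤ q
+-cancelˡ-≤ r {p} {q} = subst₂ _≤_ (-r+[r+x]≡x p) (-r+[r+x]≡x q) ∘ +-monoʳ-≤ (- r)
  where
  -r+[r+x]≡x : ∀ x → - r + (r + x) ≡ x
  -r+[r+x]≡x x = trans (sym (+-assoc (- r) r x)) (trans (cong (_+ x) (+-inverseˡ r)) (+-identityˡ x))

+₁≤+ : ∀ x y → x +₁ y ≤ x + y
+₁≤+ x y = p⊓q≤p (x + y) 1ℚ

+₁-mono-≤ : ∀ {x x′ y y′} → x ≤ x′ → y ≤ y′ → x +₁ y ≤ x′ +₁ y′
+₁-mono-≤ x≤x′ y≤y′ = ⊓-monoˡ-≤ 1ℚ (+-mono-≤ x≤x′ y≤y′)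

+₁-comm : ∀ x y → x +₁ y ≡ y +₁ x
+₁-comm x y = cong (_⊓ 1ℚ) (+-comm x y)

+₁-identityʳ : ∀ {x} → x ≤ 1ℚ → x +₁ 0ℚ ≡ x
+₁-identityʳ {x} x≤1 rewrite +-identityʳ x = p≤q⇒p⊓q≡p x≤1

+₁-identityˡ : ∀ {x} → x ≤ 1ℚ → 0ℚ +₁ x ≡ x
+₁-identityˡ {x} x≤1 rewrite +-identityˡ x = p≤q⇒p⊓q≡p x≤1

≤+⇒≤+₁ : ∀ {x y z} → x ≤ y + z → x ≤ 1ℚ → x ≤ y +₁ z
≤+⇒≤+₁ = ⊓-glb

0≤+₁ : ∀ {x y} → 0ℚ ≤ x → 0ℚ ≤ y → 0ℚ ≤ x +₁ y
0≤+₁ {x} {y} 0≤x 0≤y = ⊓-glb (subst (_≤ x + y) (+-identityʳ 0ℚ) (+-mono-≤ 0≤x 0≤y)) 0≤1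

module _ (m : ℕ) where

  frac≤1 : ∀ {k} → k ℕ.≤ suc m → frac m k ≤ 1ℚ
  frac≤1 {k} k≤n = subst (frac m k ≤_) (frac-1 m) (frac-mono-≤ m k≤n)

  S⊆Q01 : ∀ {q} → S m q → Q01 q
  S⊆Q01 (k , k≤n , refl) = subst (_≤ frac m k) (frac-0 m) (frac-mono-≤ m {0} {k} z≤n) , frac≤1 k≤n

  0∈S : S m 0ℚ
  0∈S = 0 , z≤n , sym (frac-0 m)

  frac⊓1∈S : ∀ k → S m (frac m k ⊓ 1ℚ)
  frac⊓1∈S k with ℕₚ.≤-total k (suc m)
  ... | inj₁ k≤n = k , k≤n , p≤q⇒p⊓q≡p (frac≤1 k≤n)
  ... | inj₂ n≤k = suc m , ℕₚ.≤-refl ,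
    trans (p≥q⇒p⊓q≡q (subst (_≤ frac m k) (frac-1 m) (frac-mono-≤ m n≤k))) (sym (frac-1 m))

  +₁-closed : ∀ {a b} → S m a → S m b → S m (a +₁ b)
  +₁-closed (k , _ , refl) (l , _ , refl) =
    subst (S m) (cong (_⊓ 1ℚ) (sym (frac-+ m k l))) (frac⊓1∈S (k ℕ.+ l))

  S-difference : ∀ {a s} → S m a → S m s → a ≤ s → ∃ λ s′ → S m s′ × a + s′ ≡ s
  S-difference (k , _ , refl) (l , l≤n , refl) a≤s =
    frac m (l ℕ.∸ k) , (l ℕ.∸ k , ℕₚ.≤-trans (ℕₚ.m∸n≤m l k) l≤n , refl) ,
    trans (frac-+ m k (l ℕ.∸ k)) (cong (frac m) (ℕₚ.m+[n∸m]≡n (frac-cancel-≤ m {k} {l} a≤s)))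

  SameCut : ℚ → ℚ → Set
  SameCut t r = ∀ s → S m s → t ≤ s ⇔ r ≤ s

  least-frac-above : ∀ n r → r ≤ frac m n →
    ∃ λ k → r ≤ frac m k × (∀ l → r ≤ frac m l → k ℕ.≤ l)
  least-frac-above zero r r≤0 = 0 , r≤0 , λ _ _ → z≤n
  least-frac-above (suc n) r r≤n+1 with r ≤? frac m n
  ... | yes r≤n = least-frac-above n r r≤n
  ... | no r≰n = suc n , r≤n+1 , least
    where
    least : ∀ l → r ≤ frac m l → suc n ℕ.≤ l
    least l r≤l with ℕ.suc n ℕ.≤? l
    ... | yes n<l = n<l
    ... | no n≮l = ⊥-elim (r≰n (≤-trans r≤l (frac-mono-≤ m {l} {n} (ℕₚ.≤-pred (ℕₚ.≰⇒> n≮l)))))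

  ceiling : ∀ r → r ≤ 1ℚ → ∃ λ t → S m t × SameCut t r
  ceiling r r≤1 = frac m k , (k , least (suc m) r≤frac-1 , refl) , same
    where
    r≤frac-1 : r ≤ frac m (suc m)
    r≤frac-1 = subst (r ≤_) (sym (frac-1 m)) r≤1
    least-above = least-frac-above (suc m) r r≤frac-1
    k = proj₁ least-above
    r≤k = proj₁ (proj₂ least-above)
    least = proj₂ (proj₂ least-above)
    same : SameCut (frac m k) r
    same _ (l , _ , refl) = mk⇔ (≤-trans r≤k) (frac-mono-≤ m {k} {l} ∘ least l)

min₁ : ∀ {k} → (Fin k → ℚ) → ℚ
min₁ {zero}  f = 1ℚ
min₁ {suc k} f = f zero ⊓ min₁ (f ∘ suc)

min₁-lb : ∀ {k} (f : Fin k → ℚ) j → min₁ f ≤ f j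
min₁-lb f zero    = p⊓q≤p (f zero) _
min₁-lb f (suc j) = ≤-trans (p⊓q≤q (f zero) _) (min₁-lb (f ∘ suc) j)

min₁≤1 : ∀ {k} (f : Fin k → ℚ) → min₁ f ≤ 1ℚ
min₁≤1 {zero}  f = ≤-refl
min₁≤1 {suc k} f = ≤-trans (p⊓q≤q (f zero) _) (min₁≤1 (f ∘ suc))

min₁-glb : ∀ {k} (f : Fin k → ℚ) {z} → z ≤ 1ℚ → (∀ j → z ≤ f j) → z ≤ min₁ f
min₁-glb {zero}  f z≤1 z≤f = z≤1
min₁-glb {suc k} f z≤1 z≤f = ⊓-glb (z≤f zero) (min₁-glb (f ∘ suc) z≤1 (z≤f ∘ suc))

min₁-sel : ∀ {k} (f : Fin k → ℚ) → min₁ f ≡ 1ℚ ⊎ ∃ λ j → min₁ f ≡ f j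
min₁-sel {zero}  f = inj₁ refl
min₁-sel {suc k} f with ⊓-sel (f zero) (min₁ (f ∘ suc)) | min₁-sel (f ∘ suc)
... | inj₁ e | _            = inj₂ (zero , e)
... | inj₂ e | inj₁ e′      = inj₁ (trans e e′)
... | inj₂ e | inj₂ (j , e′) = inj₂ (suc j , trans e e′)

record Deduplication {A : Set} {k : ℕ} (a : Fin k → A) : Set where
  field
    size       : ℕ
    pick       : Fin size → Fin k
    injective  : Injective _≡_ _≡_ (a ∘ pick)
    index      : Fin k → Fin size
    pick-index : ∀ i → a (pick (index i)) ≡ a i

module _ {A : Set} {k} {a : Fin (suc k) → A} (tail : Deduplication (a ∘ suc)) where
  open Deduplication tail

  deduplication-seen : ∀ p → a (suc (pick p)) ≡ a zero → Deduplication a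
  deduplication-seen p a₀-seen = record
    { size = size ; pick = suc ∘ pick ; injective = injective ; index = index′ ; pick-index = pick-index′ }
    where
    index′ : Fin (suc k) → Fin size
    index′ zero    = p
    index′ (suc i) = index i
    pick-index′ : ∀ i → a (suc (pick (index′ i))) ≡ a i
    pick-index′ zero    = a₀-seen
    pick-index′ (suc i) = pick-index i

  deduplication-new : (∀ p → a (suc (pick p)) ≢ a zero) → Deduplication a
  deduplication-new a₀-new = record
    { size = suc size ; pick = pick′ ; injective = injective′ ; index = index′ ; pick-index = pick-index′ }
    where
    pick′ : Fin (suc size) → Fin (suc k)
    pick′ zero    = zero
    pick′ (suc p) = suc (pick p)
    injective′ : Injective _≡_ _≡_ (a ∘ pick′)
    injective′ {zero}  {zero}  _ = refl
    injective′ {zero}  {suc q} e = ⊥-elim (a₀-new q (sym e))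
    injective′ {suc p} {zero}  e = ⊥-elim (a₀-new p e)
    injective′ {suc p} {suc q} e = cong suc (injective e)
    index′ : Fin (suc k) → Fin (suc size)
    index′ zero    = zero
    index′ (suc i) = suc (index i)
    pick-index′ : ∀ i → a (pick′ (index′ i)) ≡ a i
    pick-index′ zero    = refl
    pick-index′ (suc i) = pick-index i

deduplicate : ∀ {A : Set} → DecidableEquality A → ∀ {k} (a : Fin k → A) → Deduplication a
deduplicate _≟_ {zero} a = record
  { size = 0 ; pick = λ () ; injective = λ {} ; index = λ () ; pick-index = λ () }
deduplicate _≟_ {suc k} a = extend (deduplicate _≟_ (a ∘ suc))
  where
  extend : Deduplication (a ∘ suc) → Deduplication a
  extend tail with Finₚ.any? (λ p → a (suc (Deduplication.pick tail p)) ≟ a zero)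
  ... | yes (p , a₀-seen) = deduplication-seen tail p a₀-seen
  ... | no  a₀-new        = deduplication-new tail (λ p e → a₀-new (p , e))

module Extension {D : ℚ → Set} (U : MSpace D) (isU : IsUrysohn D U)
                 (0∈D : D 0ℚ) (D⊆Q01 : ∀ {q} → D q → Q01 q) where
  open MSpace U
  open IsUrysohn isU

  d≥0 : ∀ x y → 0ℚ ≤ d x y
  d≥0 x y = proj₁ (D⊆Q01 (d-in x y))

  d≤1 : ∀ x y → d x y ≤ 1ℚ
  d≤1 x y = proj₂ (D⊆Q01 (d-in x y))

  _≟ᶜ_ : DecidableEquality Carrier
  x ≟ᶜ y with d x y ≟ 0ℚ
  ... | yes dxy≡0 = yes (d-zero⇒ x y dxy≡0)
  ... | no  dxy≢0 = no (dxy≢0 ∘ d-zero⇐ x y)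

  record Katětov {k} (a : Fin k → Carrier) (t : Fin k → ℚ) : Set where
    field
      t-in  : ∀ i → D (t i)
      t-tri : ∀ i j → t i ≤ t j +₁ d (a j) (a i)
      a-tri : ∀ i j → d (a i) (a j) ≤ t i +₁ t j

  module _ {k} {a : Fin k → Carrier} {t : Fin k → ℚ} (κ : Katětov a t) where
    open Katětov κ

    t≤1 : ∀ i → t i ≤ 1ℚ
    t≤1 i = proj₂ (D⊆Q01 (t-in i))

    katětov-resp-≡ : ∀ i j → a i ≡ a j → t i ≡ t j
    katětov-resp-≡ i j ai≡aj = ≤-antisym (≤-via i j ai≡aj) (≤-via j i (sym ai≡aj))
      where
      ≤-via : ∀ i j → a i ≡ a j → t i ≤ t j
      ≤-via i j ai≡aj = subst (t i ≤_) (+₁-identityʳ (t≤1 j))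
        (subst (λ e → t i ≤ t j +₁ e) (d-zero⇐ (a j) (a i) (sym ai≡aj)) (t-tri i j))

    realised-at-zero : ∀ i → t i ≡ 0ℚ → ∀ j → d (a i) (a j) ≡ t j
    realised-at-zero i ti≡0 j = ≤-antisym
      (subst (d (a i) (a j) ≤_) (+₁-identityˡ (t≤1 j))
        (subst (λ e → d (a i) (a j) ≤ e +₁ t j) ti≡0 (a-tri i j)))
      (subst (t j ≤_) (+₁-identityˡ (d≤1 (a i) (a j)))
        (subst (λ e → t j ≤ e +₁ d (a i) (a j)) ti≡0 (t-tri j i)))

  katětov-reindex : ∀ {k n} {a : Fin k → Carrier} {t : Fin k → ℚ} →
    Katětov a t → (f : Fin n → Fin k) → Katětov (a ∘ f) (t ∘ f)
  katětov-reindex κ f = record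
    { t-in = t-in ∘ f ; t-tri = λ i j → t-tri (f i) (f j) ; a-tri = λ i j → a-tri (f i) (f j) }
    where open Katětov κ

  module _ {n} {b : Fin n → Carrier} {u : Fin n → ℚ} where

    onePoint : Fin (suc n) → Fin (suc n) → ℚ
    onePoint zero    zero    = 0ℚ
    onePoint zero    (suc q) = u q
    onePoint (suc p) zero    = u p
    onePoint (suc p) (suc q) = d (b p) (b q)

    onePoint-isFinMetric : Injective _≡_ _≡_ b → Katětov b u → (∀ p → u p ≢ 0ℚ) →
      IsFinMetric D (suc n) onePoint
    onePoint-isFinMetric b-inj κ u≢0 = record
      { δ-in = δ-in ; δ-zero⇒ = δ-zero⇒ ; δ-zero⇐ = δ-zero⇐ ; δ-sym = δ-sym ; δ-tri = δ-tri }
      where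
      open Katětov κ
      δ-in : ∀ i j → D (onePoint i j)
      δ-in zero    zero    = 0∈D
      δ-in zero    (suc q) = t-in q
      δ-in (suc p) zero    = t-in p
      δ-in (suc p) (suc q) = d-in (b p) (b q)
      δ-zero⇒ : ∀ i j → onePoint i j ≡ 0ℚ → i ≡ j
      δ-zero⇒ zero    zero    _ = refl
      δ-zero⇒ zero    (suc q) e = ⊥-elim (u≢0 q e)
      δ-zero⇒ (suc p) zero    e = ⊥-elim (u≢0 p e)
      δ-zero⇒ (suc p) (suc q) e = cong suc (b-inj (d-zero⇒ (b p) (b q) e))
      δ-zero⇐ : ∀ i j → i ≡ j → onePoint i j ≡ 0ℚ
      δ-zero⇐ zero    _ refl = refl
      δ-zero⇐ (suc p) _ refl = d-zero⇐ (b p) (b p) refl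
      δ-sym : ∀ i j → onePoint i j ≡ onePoint j i
      δ-sym zero    zero    = refl
      δ-sym zero    (suc q) = refl
      δ-sym (suc p) zero    = refl
      δ-sym (suc p) (suc q) = d-sym (b p) (b q)
      δ-tri : ∀ i j l → onePoint i l ≤ onePoint i j +₁ onePoint j l
      δ-tri zero    zero    zero    = 0≤+₁ ≤-refl ≤-refl
      δ-tri zero    zero    (suc q) = ≤-reflexive (sym (+₁-identityˡ (t≤1 κ q)))
      δ-tri zero    (suc p) zero    = 0≤+₁ (proj₁ (D⊆Q01 (t-in p))) (proj₁ (D⊆Q01 (t-in p)))
      δ-tri zero    (suc p) (suc q) = t-tri q p
      δ-tri (suc p) zero    zero    = ≤-reflexive (sym (+₁-identityʳ (t≤1 κ p)))
      δ-tri (suc p) zero    (suc q) = a-tri p q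
      δ-tri (suc p) (suc q) zero    =
        subst (u p ≤_) (+₁-comm (u q) _) (subst (λ e → u p ≤ u q +₁ e) (d-sym (b q) (b p)) (t-tri p q))
      δ-tri (suc p) (suc q) (suc r) = d-tri (b p) (b q) (b r)

    realise-injective : Injective _≡_ _≡_ b → Katětov b u → (∀ p → u p ≢ 0ℚ) →
      ∃ λ y → ∀ p → d y (b p) ≡ u p
    realise-injective b-inj κ u≢0 = g (e zero) , λ p → begin-equality
      d (g (e zero)) (b p)             ≡⟨ cong (d (g (e zero))) (g-e p) ⟨
      d (g (e zero)) (g (e (suc p)))   ≡⟨ g-isometry (e zero) (e (suc p)) ⟩
      d (e zero) (e (suc p))           ≡⟨ e-isometry zero (suc p) ⟩
      u p                              ∎
      where
      open ≤-Reasoning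
      embedding = universal (suc n) onePoint (onePoint-isFinMetric b-inj κ u≢0)
      e = proj₁ embedding
      e-isometry = proj₂ embedding
      automorphism = ultrahomogeneous n (e ∘ suc) b (λ p q → e-isometry (suc p) (suc q))
      g = proj₁ automorphism
      g-isometry = proj₁ (proj₂ automorphism)
      g-e = proj₂ (proj₂ (proj₂ automorphism))

  extension : ∀ {k} {a : Fin k → Carrier} {t : Fin k → ℚ} →
    Katětov a t → ∃ λ y → ∀ i → d y (a i) ≡ t i
  extension {a = a} {t} κ with Finₚ.any? (λ i → t i ≟ 0ℚ)
  ... | yes (i , ti≡0) = a i , realised-at-zero κ i ti≡0
  ... | no  t≢0 = y , λ i → begin-equality
      d y (a i)                    ≡⟨ cong (d y) (pick-index i) ⟨
      d y (a (pick (index i)))     ≡⟨ y-realises (index i) ⟩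
      t (pick (index i))           ≡⟨ katětov-resp-≡ κ _ i (pick-index i) ⟩
      t i                          ∎
    where
    open ≤-Reasoning
    open Deduplication (deduplicate _≟ᶜ_ a)
    realisation = realise-injective injective (katětov-reindex κ pick) (λ p e → t≢0 (pick p , e))
    y = proj₁ realisation
    y-realises = proj₂ realisation

module BackAndForth {D₁ D₂ : ℚ → Set} (M₁ : MSpace D₁) (M₂ : MSpace D₂) (P : ℚ → Set)
  (R : ∀ {k} → (Fin k → MSpace.Carrier M₁) → (Fin k → MSpace.Carrier M₂) → Set)
  (R-≡ : ∀ {k a b} → R {k} a b → ∀ i j → a i ≡ a j ⇔ b i ≡ b j)
  (R-≤ : ∀ {k a b} → R {k} a b → ∀ i j s → P s →
         MSpace.d M₁ (a i) (a j) ≤ s ⇔ MSpace.d M₂ (b i) (b j) ≤ s)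
  (forth : ∀ {k a b} → R {k} a b → ∀ x → ∃ λ y → R (ext M₁ a x) (ext M₂ b y))
  (back  : ∀ {k a b} → R {k} a b → ∀ y → ∃ λ x → R (ext M₁ a x) (ext M₂ b y))
  where
  open Equivalence using (to; from)

  Sat-⇔ : ∀ {k} (φ : Formula k) → InL P φ → ∀ {a b} → R a b → Sat M₁ φ a ⇔ Sat M₂ φ b
  Sat-⇔ (i ≐ j)     _         r = R-≡ r i j
  Sat-⇔ (dle s i j) s∈P       r = R-≤ r i j s s∈P
  Sat-⇔ (~ φ)       φ∈L       r = ¬-cong-⇔ (Sat-⇔ φ φ∈L r)
  Sat-⇔ (φ ∧ ψ)     (φ∈L , ψ∈L) r = Sat-⇔ φ φ∈L r ×-⇔ Sat-⇔ ψ ψ∈L r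
  Sat-⇔ (all φ)     φ∈L       r = mk⇔
    (λ M₁⊨φ y → let x , r′ = back r y  in to   (Sat-⇔ φ φ∈L r′) (M₁⊨φ x))
    (λ M₂⊨φ x → let y , r′ = forth r x in from (Sat-⇔ φ φ∈L r′) (M₂⊨φ y))

module QuantisedTransfer (m : ℕ) (UQ : MSpace Q01) (isUQ : IsUrysohn Q01 UQ)
                         (US : MSpace (S m)) (isUS : IsUrysohn (S m) US) where
  module Q = MSpace UQ
  module Sₘ = MSpace US
  module EQ = Extension UQ isUQ (≤-refl , 0≤1) (λ q∈Q01 → q∈Q01)
  module ES = Extension US isUS (0∈S m) (S⊆Q01 m)
  open Equivalence using (to; from)

  SameCut⇒≤ : ∀ {t r} → SameCut m t r → S m t → r ≤ t
  SameCut⇒≤ t~r t∈S = to (t~r _ t∈S) ≤-refl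

  SameCuts : ∀ {k} → (Fin k → Sₘ.Carrier) → (Fin k → Q.Carrier) → Set
  SameCuts a b = ∀ i j → SameCut m (Sₘ.d (a i) (a j)) (Q.d (b i) (b j))

  SameCuts-≡ : ∀ {k a b} → SameCuts {k} a b → ∀ i j → a i ≡ a j ⇔ b i ≡ b j
  SameCuts-≡ rel i j = mk⇔
    (λ ai≡aj → Q.d-zero⇒ _ _ (≤-antisym
      (to (rel i j 0ℚ (0∈S m)) (≤-reflexive (Sₘ.d-zero⇐ _ _ ai≡aj))) (EQ.d≥0 _ _)))
    (λ bi≡bj → Sₘ.d-zero⇒ _ _ (≤-antisym
      (from (rel i j 0ℚ (0∈S m)) (≤-reflexive (Q.d-zero⇐ _ _ bi≡bj))) (ES.d≥0 _ _)))

  SameCuts-ext : ∀ {k a b} → SameCuts {k} a b → ∀ x y →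
    (∀ j → SameCut m (Sₘ.d x (a j)) (Q.d y (b j))) → SameCuts (ext US a x) (ext UQ b y)
  SameCuts-ext rel x y new zero    zero    =
    subst₂ (SameCut m) (sym (Sₘ.d-zero⇐ x x refl)) (sym (Q.d-zero⇐ y y refl)) (λ _ _ → ⇔-id _)
  SameCuts-ext rel x y new zero    (suc j) = new j
  SameCuts-ext rel x y new (suc i) zero    = subst₂ (SameCut m) (Sₘ.d-sym _ _) (Q.d-sym _ _) (new i)
  SameCuts-ext rel x y new (suc i) (suc j) = rel i j

  back : ∀ {k a b} → SameCuts {k} a b → ∀ y → ∃ λ x → SameCuts (ext US a x) (ext UQ b y)
  back {k} {a} {b} rel y =
    x , SameCuts-ext rel x y (λ j → subst (λ e → SameCut m e (r j)) (sym (x-realises j)) (t~r j))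
    where
    r : Fin k → ℚ
    r j = Q.d y (b j)
    ceil : ∀ j → ∃ λ t → S m t × SameCut m t (r j)
    ceil j = ceiling m (r j) (EQ.d≤1 _ _)
    t : Fin k → ℚ
    t = proj₁ ∘ ceil
    t∈S : ∀ j → S m (t j)
    t∈S = proj₁ ∘ proj₂ ∘ ceil
    t~r : ∀ j → SameCut m (t j) (r j)
    t~r = proj₂ ∘ proj₂ ∘ ceil
    dQ≤dS : ∀ i j → Q.d (b i) (b j) ≤ Sₘ.d (a i) (a j)
    dQ≤dS i j = SameCut⇒≤ (rel i j) (Sₘ.d-in _ _)
    κ : ES.Katětov a t
    κ = record
      { t-in  = t∈S
      ; t-tri = λ i j → from (t~r i _ (+₁-closed m (t∈S j) (Sₘ.d-in _ _)))
          (≤-trans (Q.d-tri y (b j) (b i)) (+₁-mono-≤ (SameCut⇒≤ (t~r j) (t∈S j)) (dQ≤dS j i)))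
      ; a-tri = λ i j → from (rel i j _ (+₁-closed m (t∈S i) (t∈S j)))
          (≤-trans (Q.d-tri (b i) y (b j))
            (+₁-mono-≤ (subst (_≤ t i) (Q.d-sym _ _) (SameCut⇒≤ (t~r i) (t∈S i))) (SameCut⇒≤ (t~r j) (t∈S j))))
      }
    x = proj₁ (ES.extension κ)
    x-realises = proj₂ (ES.extension κ)

  module Forth {k} {a : Fin k → Sₘ.Carrier} {b : Fin k → Q.Carrier} (rel : SameCuts a b) (z : Sₘ.Carrier) where
    open ≤-Reasoning

    t : Fin k → ℚ
    t j = Sₘ.d z (a j)

    dq : Fin k → Fin k → ℚ
    dq i j = Q.d (b i) (b j)

    r : Fin k → ℚ
    r i = min₁ (λ j → dq i j + t j)

    r≤dq+t : ∀ i j → r i ≤ dq i j + t j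
    r≤dq+t i = min₁-lb (λ j → dq i j + t j)

    r≤t : ∀ i → r i ≤ t i
    r≤t i = subst (r i ≤_) (trans (cong (_+ t i) (Q.d-zero⇐ _ _ refl)) (+-identityˡ (t i))) (r≤dq+t i i)

    r∈Q01 : ∀ i → Q01 (r i)
    r∈Q01 i = min₁-glb _ 0≤1 (λ j → ≤-trans (EQ.d≥0 _ _) (p≤p+q (dq i j) (ES.d≥0 _ _))) , min₁≤1 (λ j → dq i j + t j)

    dq-tri : ∀ i j l → dq i l ≤ dq i j + dq j l
    dq-tri i j l = ≤-trans (Q.d-tri (b i) (b j) (b l)) (+₁≤+ (dq i j) (dq j l))

    dq≤t+t : ∀ i j → dq i j ≤ t i + t j
    dq≤t+t i j = begin
      dq i j                          ≤⟨ SameCut⇒≤ (rel i j) (Sₘ.d-in _ _) ⟩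
      Sₘ.d (a i) (a j)                ≤⟨ Sₘ.d-tri (a i) z (a j) ⟩
      Sₘ.d (a i) z +₁ t j             ≤⟨ +₁≤+ (Sₘ.d (a i) z) (t j) ⟩
      Sₘ.d (a i) z + t j              ≡⟨ cong (_+ t j) (Sₘ.d-sym (a i) z) ⟩
      t i + t j                       ∎

    r≤r+dq : ∀ i j → r i ≤ r j + dq j i
    r≤r+dq i j with min₁-sel (λ l → dq j l + t l)
    ... | inj₁ rj≡1 = ≤-trans (proj₂ (r∈Q01 i)) (subst (λ e → 1ℚ ≤ e + dq j i) (sym rj≡1) (p≤p+q 1ℚ (EQ.d≥0 _ _)))
    ... | inj₂ (l , rj≡) = begin
      r i                        ≤⟨ r≤dq+t i l ⟩
      dq i l + t l               ≤⟨ +-monoˡ-≤ (t l) (dq-tri i j l) ⟩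
      (dq i j + dq j l) + t l    ≡⟨ cong (λ e → (e + dq j l) + t l) (Q.d-sym (b i) (b j)) ⟩
      (dq j i + dq j l) + t l    ≡⟨ +-assoc (dq j i) (dq j l) (t l) ⟩
      dq j i + (dq j l + t l)    ≡⟨ +-comm (dq j i) _ ⟩
      (dq j l + t l) + dq j i    ≡⟨ cong (_+ dq j i) rj≡ ⟨
      r j + dq j i               ∎

    dq≤r+r : ∀ i j → dq i j ≤ r i + r j
    dq≤r+r i j with min₁-sel (λ l → dq i l + t l) | min₁-sel (λ l → dq j l + t l)
    ... | inj₁ ri≡1 | _ =
      ≤-trans (EQ.d≤1 _ _) (subst (λ e → 1ℚ ≤ e + r j) (sym ri≡1) (p≤p+q 1ℚ (proj₁ (r∈Q01 j))))
    ... | inj₂ _ | inj₁ rj≡1 =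
      ≤-trans (EQ.d≤1 _ _) (subst (λ e → 1ℚ ≤ r i + e) (sym rj≡1) (p≤q+p 1ℚ (proj₁ (r∈Q01 i))))
    ... | inj₂ (k′ , ri≡) | inj₂ (l , rj≡) = begin
      dq i j                                    ≤⟨ dq-tri i k′ j ⟩
      dq i k′ + dq k′ j                         ≤⟨ +-monoʳ-≤ (dq i k′) (dq-tri k′ l j) ⟩
      dq i k′ + (dq k′ l + dq l j)              ≤⟨ +-monoʳ-≤ (dq i k′) (+-mono-≤ (dq≤t+t k′ l) (≤-reflexive (Q.d-sym _ _))) ⟩
      dq i k′ + ((t k′ + t l) + dq j l)         ≡⟨ cong (λ e → dq i k′ + e) (+-assoc (t k′) (t l) (dq j l)) ⟩
      dq i k′ + (t k′ + (t l + dq j l))         ≡⟨ +-assoc (dq i k′) (t k′) _ ⟨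
      (dq i k′ + t k′) + (t l + dq j l)         ≡⟨ cong (λ e → (dq i k′ + t k′) + e) (+-comm (t l) (dq j l)) ⟩
      (dq i k′ + t k′) + (dq j l + t l)         ≡⟨ cong₂ _+_ ri≡ rj≡ ⟨
      r i + r j                                 ∎

    κ : EQ.Katětov b r
    κ = record
      { t-in  = r∈Q01
      ; t-tri = λ i j → ≤+⇒≤+₁ {y = r j} {dq j i} (r≤r+dq i j) (proj₂ (r∈Q01 i))
      ; a-tri = λ i j → ≤+⇒≤+₁ {y = r i} {r j} (dq≤r+r i j) (EQ.d≤1 _ _)
      }

    t~r : ∀ i → SameCut m (t i) (r i)
    t~r i s s∈S = mk⇔ (≤-trans (r≤t i)) r≤s⇒t≤s
      where
      r≤s⇒t≤s : r i ≤ s → t i ≤ s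
      r≤s⇒t≤s ri≤s with min₁-sel (λ l → dq i l + t l)
      ... | inj₁ ri≡1 = ≤-trans (ES.d≤1 _ _) (subst (_≤ s) ri≡1 ri≤s)
      ... | inj₂ (j , ri≡) = begin
        t i                           ≤⟨ Sₘ.d-tri z (a j) (a i) ⟩
        t j +₁ Sₘ.d (a j) (a i)       ≤⟨ +₁≤+ (t j) _ ⟩
        t j + Sₘ.d (a j) (a i)        ≤⟨ +-monoʳ-≤ (t j) (from (rel j i s′ s′∈S) dq≤s′) ⟩
        t j + s′                      ≡⟨ tj+s′≡s ⟩
        s                             ∎
        where
        -- s′ = s − t j is a threshold in S m, at which rel transfers the cut of dq j i
        dq+t≤s : dq i j + t j ≤ s
        dq+t≤s = subst (_≤ s) ri≡ ri≤s
        difference = S-difference m (Sₘ.d-in z (a j)) s∈S (≤-trans (p≤q+p (t j) (EQ.d≥0 _ _)) dq+t≤s)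
        s′ = proj₁ difference
        s′∈S = proj₁ (proj₂ difference)
        tj+s′≡s = proj₂ (proj₂ difference)
        dq≤s′ : dq j i ≤ s′
        dq≤s′ = +-cancelˡ-≤ (t j) (subst₂ _≤_
          (trans (+-comm (dq i j) (t j)) (cong (λ e → t j + e) (Q.d-sym (b i) (b j)))) (sym tj+s′≡s) dq+t≤s)

  forth : ∀ {k a b} → SameCuts {k} a b → ∀ z → ∃ λ w → SameCuts (ext US a z) (ext UQ b w)
  forth rel z = w , SameCuts-ext rel z w (λ j → subst (SameCut m (t j)) (sym (w-realises j)) (t~r j))
    where
    open Forth rel z
    w = proj₁ (EQ.extension κ)
    w-realises = proj₂ (EQ.extension κ)

  open BackAndForth US UQ (S m) SameCuts SameCuts-≡ (λ rel → rel) forth back public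

Q01∩denominator∣⇒S : ∀ m q → Q01 q → suc (ℚ.denominator-1 q) ∣ suc m → S m q
Q01∩denominator∣⇒S m (mkℚ -[1+ _ ] _ _) (*≤* () , _) _
Q01∩denominator∣⇒S m q@(mkℚ (+ k) n _) (_ , *≤* k*1≤1*n) (divides c m≡cn) =
  k ℕ.* c , k*c≤m , sym (trans (frac-rescale m n k c m≡cn) (↥p/↧p≡p q))
  where
  k≤n : k ℕ.≤ suc n
  k≤n = ℤₚ.drop‿+≤+ (subst₂ ℤ._≤_ (ℤₚ.*-identityʳ (+ k)) (ℤₚ.*-identityˡ (+ suc n)) k*1≤1*n)
  k*c≤m : k ℕ.* c ℕ.≤ suc m
  k*c≤m = subst (k ℕ.* c ℕ.≤_) (trans (ℕₚ.*-comm (suc n) c) (sym m≡cn)) (ℕₚ.*-monoˡ-≤ c k≤n)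

-- suc (commonDenominator-1 φ) is the product of the denominators of the constants of φ
commonDenominator-1 : ∀ {n} → Formula n → ℕ
commonDenominator-1 (i ≐ j)     = 0
commonDenominator-1 (dle s i j) = ℚ.denominator-1 s
commonDenominator-1 (~ φ)       = commonDenominator-1 φ
commonDenominator-1 (φ ∧ ψ)     = ℕ.pred (suc (commonDenominator-1 φ) ℕ.* suc (commonDenominator-1 ψ))
commonDenominator-1 (all φ)     = commonDenominator-1 φ

InL-Q01⇒InL-S : ∀ {n} (φ : Formula n) → InL Q01 φ → ∀ m → suc (commonDenominator-1 φ) ∣ suc m → InL (S m) φ
InL-Q01⇒InL-S (i ≐ j)     _           m _ = tt
InL-Q01⇒InL-S (dle s i j) s∈Q01       m ∣m = Q01∩denominator∣⇒S m s s∈Q01 ∣m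
InL-Q01⇒InL-S (~ φ)       φ∈L         m ∣m = InL-Q01⇒InL-S φ φ∈L m ∣m
InL-Q01⇒InL-S (φ ∧ ψ)     (φ∈L , ψ∈L) m ∣m =
  InL-Q01⇒InL-S φ φ∈L m (∣-trans (m∣m*n (suc (commonDenominator-1 ψ))) ∣m) ,
  InL-Q01⇒InL-S ψ ψ∈L m (∣-trans (n∣m*n (suc (commonDenominator-1 φ))) ∣m)
InL-Q01⇒InL-S (all φ)     φ∈L         m ∣m = InL-Q01⇒InL-S φ φ∈L m ∣m

InL-mono : ∀ {P Q : ℚ → Set} → (∀ {q} → P q → Q q) → ∀ {n} (φ : Formula n) → InL P φ → InL Q φ
InL-mono P⊆Q (i ≐ j)     _           = tt
InL-mono P⊆Q (dle s i j) s∈P         = P⊆Q s∈P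
InL-mono P⊆Q (~ φ)       φ∈L         = InL-mono P⊆Q φ φ∈L
InL-mono P⊆Q (φ ∧ ψ)     (φ∈L , ψ∈L) = InL-mono P⊆Q φ φ∈L , InL-mono P⊆Q ψ ψ∈L
InL-mono P⊆Q (all φ)     φ∈L         = InL-mono P⊆Q φ φ∈L

proposition7p5 : (UQ : MSpace Q01) → IsUrysohn Q01 UQ →
    (US : (m : ℕ) → MSpace (S m)) → ((m : ℕ) → IsUrysohn (S m) (US m)) →
    (φ : Sentence) →
      (InTh Q01 UQ φ → Σ ℕ (λ m → InTh (S m) (US m) φ)) ×
      (Σ ℕ (λ m → InTh (S m) (US m) φ) → InTh Q01 UQ φ)
proposition7p5 UQ isUQ US isUS φ = forward , backward
  where
  open Equivalence using (to; from)
  transfer : ∀ m → InL (S m) φ → US m ⊨ φ ⇔ UQ ⊨ φ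
  transfer m φ∈L = QuantisedTransfer.Sat-⇔ m UQ isUQ (US m) (isUS m) φ φ∈L (λ ())

  forward : InTh Q01 UQ φ → Σ ℕ (λ m → InTh (S m) (US m) φ)
  forward (φ∈L , UQ⊨φ) = m , φ∈Lₘ , from (transfer m φ∈Lₘ) UQ⊨φ
    where
    m = commonDenominator-1 φ
    φ∈Lₘ = InL-Q01⇒InL-S φ φ∈L m ∣-refl

  backward : Σ ℕ (λ m → InTh (S m) (US m) φ) → InTh Q01 UQ φ
  backward (m , φ∈Lₘ , USₘ⊨φ) = InL-mono (S⊆Q01 m) φ φ∈Lₘ , to (transfer m φ∈Lₘ) USₘ⊨φ
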